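{- A formula $\varphi$ of $\mathcal L$ is satisfiable (respectively, falsifiable) in some intuitionistic dynamic model if and only if it is satisfiable (respectively, falsifiable) in some expanding model.
   Context: Formulas of $\mathcal L$: $\varphi::= p\mid\bot\mid\varphi\wedge\varphi\mid\varphi\vee\varphi\mid\varphi\to\varphi\mid\bigcirc\varphi\mid\Diamond\varphi\mid\Box\varphi$, $p$ in a countable set $\mathbb P$. An intuitionistic dynamic model is $\mathcal M=(W,\preccurlyeq,S,V)$ with $W\neq\emptyset$, $\preccurlyeq$ a partial order, $S\colon W\to W$ with $w\preccurlyeq v\Rightarrow S(w)\preccurlyeq S(v)$, and $V\colon W\to 2^{\mathbb P}$ with $w\preccurlyeq v\Rightarrow V(w)\subseteq V(v)$. With $S^0(w)=w$, $S^{k+1}(w)=S(S^k(w))$: $w\models p$ iff $p\in V(w)$; $\bot$ never; $\wedge,\vee$ as usual; $w\models\varphi\to\psi$ iff for all $v\succcurlyeq w$, $v\models\varphi$ implies $v\models\psi$; $w\models\bigcirc\varphi$ iff $S(w)\models\varphi$; $w\models\Diamond\varphi$ iff $S^k(w)\models\varphi$ for some $k\ge0$; $w\models\Box\varphi$ iff $S^k(w)\models\varphi$ for all $k\ge0$. Satisfiable: true at some world of the model; falsifiable: false at some world of the model. A poset $(U,\le)$ is a tree if there is a relation $\lhd$ on $U$ whose reflexive transitive closure is $\le$ and an element $r$ (the root) such that for every $u\in U$ there is a unique finite sequence $r=v_0\lhd v_1\lhd\dots\lhd v_n=u$. A model is stratified if there is a partition $\{W_n\}_{n<\omega}$ of $W$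 such that (i) each $W_n$ is closed under $\preccurlyeq$, (ii) each $(W_n,\preccurlyeq\restriction W_n)$ is a tree, and (iii) $w\in W_n$ implies $S(w)\in W_{n+1}$. An expanding model is a stratified model that moreover satisfies: $S(w)\preccurlyeq S(v)$ implies $w\preccurlyeq v$. -}

module Defs where

open import Level using (0ℓ)
open import Data.Nat.Base using (ℕ; zero; suc)
open import Data.Empty using (⊥)
open import Data.Product using (Σ; ∃; ∃-syntax; _×_; _,_; proj₁)
open import Data.Sum using (_⊎_)
open import Data.List.Base using (List; []; _∷_)
open import Relation.Binary.Core using (Rel)
open import Relation.Binary.Structures using (IsPartialOrder)
open import Relation.Binary.PropositionalEquality using (_≡_)
open import Relation.Binary.Construct.Closure.ReflexiveTransitive using (Star)

infixr 6 _∧'_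
infixr 5 _∨'_
infixr 4 _⇒_

data Form : Set where
  var  : ℕ → Form
  ⊥'   : Form
  _∧'_ : Form → Form → Form
  _∨'_ : Form → Form → Form
  _⇒_  : Form → Form → Form
  ○    : Form → Form
  ◇    : Form → Form
  □    : Form → Form

iter : {A : Set} → (A → A) → ℕ → A → A
iter f zero    x = x
iter f (suc k) x = f (iter f k x)

record IDM : Set₁ where
  field
    W      : Set
    _≼_    : Rel W 0ℓ
    isPO   : IsPartialOrder _≡_ _≼_
    S      : W → W
    S-mono : ∀ {w v} → w ≼ v → S w ≼ S v
    V      : W → ℕ → Set
    V-mono : ∀ {w v} → w ≼ v → ∀ p → V w p → V v p

_,_⊨_ : (M : IDM) → IDM.W M → Form → Set
M , w ⊨ var p    = IDM.V M w p
M , w ⊨ ⊥'       = ⊥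
M , w ⊨ (φ ∧' ψ) = (M , w ⊨ φ) × (M , w ⊨ ψ)
M , w ⊨ (φ ∨' ψ) = (M , w ⊨ φ) ⊎ (M , w ⊨ ψ)
M , w ⊨ (φ ⇒ ψ)  = ∀ v → IDM._≼_ M w v → M , v ⊨ φ → M , v ⊨ ψ
M , w ⊨ ○ φ      = M , IDM.S M w ⊨ φ
M , w ⊨ ◇ φ      = ∃[ k ] (M , iter (IDM.S M) k w ⊨ φ)
M , w ⊨ □ φ      = ∀ k → M , iter (IDM.S M) k w ⊨ φ

-- ChainTo R a xs b : the sequence a ∷ xs is a finite R-chain a = v₀ R v₁ R … R vₙ = b
ChainTo : {U : Set} → Rel U 0ℓ → U → List U → U → Set
ChainTo R a []       b = a ≡ b
ChainTo R a (x ∷ xs) b = R a x × ChainTo R x xs b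

IsTree : (U : Set) → Rel U 0ℓ → Set₁
IsTree U _≤_ =
  Σ (Rel U 0ℓ) λ _◁_ →
    (∀ a b → (a ≤ b → Star _◁_ a b) × (Star _◁_ a b → a ≤ b)) ×
    Σ U λ r → ∀ u →
      (∃[ xs ] ChainTo _◁_ r xs u) ×
      (∀ xs ys → ChainTo _◁_ r xs u → ChainTo _◁_ r ys u → xs ≡ ys)

-- Stratified: partition {Wₙ} given by the layer map (Wₙ = layer⁻¹(n)).
-- Each Wₙ is ≼-closed (upward; for a partition this implies downward too),
-- a tree under the restricted order, and S maps Wₙ into Wₙ₊₁.
IsStratifiedBy : (M : IDM) → (IDM.W M → ℕ) → Set₁
IsStratifiedBy M layer =
  (∀ {w v} → w ≼ v → layer v ≡ layer w) ×
  (∀ n → IsTree (Σ W λ w → layer w ≡ n) (λ a b → proj₁ a ≼ proj₁ b)) ×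
  (∀ w → layer (S w) ≡ suc (layer w))
  where open IDM M

IsStratified : IDM → Set₁
IsStratified M = Σ (IDM.W M → ℕ) (IsStratifiedBy M)

IsExpanding : IDM → Set₁
IsExpanding M = IsStratified M × (∀ {w v} → S w ≼ S v → w ≼ v)
  where open IDM M

module Submission where

open import Defs
open import Data.Product using (_×_; ∃-syntax)
open import Relation.Nullary using (¬_)
open import Function.Bundles using (_⇔_)

-- Proof idea (unravelling).  The interesting directions are from an arbitrary
-- intuitionistic dynamic model M, w to an expanding one; the converses hold
-- because expanding models are models.
--
-- 1. Bounded morphisms.  A map N → M that is monotone, has the "back" property
--    for ≼, commutes with S and preserves the valuation preserves and reflects
--    the truth of every formula (truth-invariance).
-- 2. Unravelling.  Given M and w₀, a *history* is a finite itinerary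
--    w₀ = v₀, v₁, …, vₙ with S^{eᵢ}(vᵢ₋₁) ≼ vᵢ.  The points of the new model are
--    pairs (h, d), read as "d time steps after the end of h", projected to
--    S^d(last h).  The layer of (h, d) is the total time elapsed, S moves one
--    layer up, and inside a layer the order is the prefix order on histories.
--    The projection is a bounded morphism onto M (back: extend the history).
-- 3. Each layer is a tree rooted at (root, n) whose immediate-successor relation
--    is one-step extension of histories, and S(x) ≼ S(y) ⇒ x ≼ y holds because
--    S does not change the history; so the unravelling is expanding.
-- The theorem follows by transporting (non-)truth along the projection.

open import Level using (0ℓ)
open import Data.Nat.Base using (ℕ; zero; suc; _+_; _≤_; s≤s)
open import Data.Nat.Properties
  using (≤-refl; ≤-trans; ≤-reflexive; m≤n⇒m≤1+n; <-irrefl; +-assoc; +-comm; +-suc;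
         +-identityʳ; +-cancelˡ-≡; suc-injective; ≡-irrelevant)
open import Data.Product using (Σ; _,_; proj₁; proj₂)
open import Data.Sum using (inj₁; inj₂)
open import Data.Empty using (⊥; ⊥-elim)
open import Data.List.Base using ([]; _∷_)
open import Relation.Binary.Core using (Rel)
open import Relation.Binary.Structures using (IsPartialOrder)
open import Relation.Binary.PropositionalEquality
open import Relation.Binary.Construct.Closure.ReflexiveTransitive using (Star; ε; _◅_; _◅◅_)
open import Function.Base using (id)
open import Function.Bundles using (mk⇔; Equivalence)

iter-+ : {A : Set} (f : A → A) (m n : ℕ) (x : A) → iter f (m + n) x ≡ iter f m (iter f n x)
iter-+ f zero    n x = refl
iter-+ f (suc m) n x = cong f (iter-+ f m n x)

iter-commute : {A B : Set} (f : A → A) (g : B → B) (h : A → B) →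
               (∀ x → h (f x) ≡ g (h x)) → ∀ k x → h (iter f k x) ≡ iter g k (h x)
iter-commute f g h comm zero    x = refl
iter-commute f g h comm (suc k) x = trans (comm (iter f k x)) (cong g (iter-commute f g h comm k x))

iter-mono : (M : IDM) → ∀ k {a b} → IDM._≼_ M a b → IDM._≼_ M (iter (IDM.S M) k a) (iter (IDM.S M) k b)
iter-mono M zero    a≼b = a≼b
iter-mono M (suc k) a≼b = IDM.S-mono M (iter-mono M k a≼b)

star⇒chain : {U : Set} {R : Rel U 0ℓ} {a b : U} → Star R a b → ∃[ xs ] ChainTo R a xs b
star⇒chain ε = [] , refl
star⇒chain (_◅_ {j = y} s rest) with star⇒chain rest
... | xs , chain = y ∷ xs , s , chain

chain⇒star : {U : Set} {R : Rel U 0ℓ} {a b : U} → ∀ xs → ChainTo R a xs b → Star R a b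
chain⇒star []       refl          = ε
chain⇒star (x ∷ xs) (s , chain) = s ◅ chain⇒star xs chain

record BoundedMorphism (N M : IDM) : Set where
  field
    map     : IDM.W N → IDM.W M
    forth   : ∀ {x y} → IDM._≼_ N x y → IDM._≼_ M (map x) (map y)
    back    : ∀ {x v} → IDM._≼_ M (map x) v → ∃[ y ] (IDM._≼_ N x y × map y ≡ v)
    commute : ∀ x → map (IDM.S N x) ≡ IDM.S M (map x)
    val     : ∀ x p → IDM.V N x p ⇔ IDM.V M (map x) p

module _ {N M : IDM} (f : BoundedMorphism N M) where
  open BoundedMorphism f

  private
    map-iter : ∀ k x → map (iter (IDM.S N) k x) ≡ iter (IDM.S M) k (map x)
    map-iter = iter-commute (IDM.S N) (IDM.S M) map commute

    along : ∀ φ {u v} → u ≡ v → M , u ⊨ φ → M , v ⊨ φ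
    along φ = subst (λ z → M , z ⊨ φ)

  mutual
    forward : ∀ φ x → N , x ⊨ φ → M , map x ⊨ φ
    forward (var p)  x m        = Equivalence.to (val x p) m
    forward ⊥'       x ()
    forward (φ ∧' ψ) x (a , b)  = forward φ x a , forward ψ x b
    forward (φ ∨' ψ) x (inj₁ a) = inj₁ (forward φ x a)
    forward (φ ∨' ψ) x (inj₂ b) = inj₂ (forward ψ x b)
    forward (φ ⇒ ψ)  x g v x≼v m with back x≼v
    ... | y , x≼y , refl = forward ψ y (g y x≼y (backward φ y m))
    forward (○ φ)    x m        = along φ (commute x) (forward φ (IDM.S N x) m)
    forward (◇ φ)    x (k , m)  = k , along φ (map-iter k x) (forward φ _ m)
    forward (□ φ)    x m k      = along φ (map-iter k x) (forward φ _ (m k))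

    backward : ∀ φ x → M , map x ⊨ φ → N , x ⊨ φ
    backward (var p)  x m        = Equivalence.from (val x p) m
    backward ⊥'       x ()
    backward (φ ∧' ψ) x (a , b)  = backward φ x a , backward ψ x b
    backward (φ ∨' ψ) x (inj₁ a) = inj₁ (backward φ x a)
    backward (φ ∨' ψ) x (inj₂ b) = inj₂ (backward ψ x b)
    backward (φ ⇒ ψ)  x g y x≼y m = backward ψ y (g (map y) (forth x≼y) (forward φ y m))
    backward (○ φ)    x m        = backward φ (IDM.S N x) (along φ (sym (commute x)) m)
    backward (◇ φ)    x (k , m)  = k , backward φ _ (along φ (sym (map-iter k x)) m)
    backward (□ φ)    x m k      = backward φ _ (along φ (sym (map-iter k x)) (m k))

  truth-invariance : ∀ φ x → (N , x ⊨ φ) ⇔ (M , map x ⊨ φ)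
  truth-invariance φ x = mk⇔ (forward φ x) (backward φ x)

module Unravelling (M : IDM) (w₀ : IDM.W M) where
  open IDM M
  open IsPartialOrder isPO using () renaming (refl to ≼-refl; trans to ≼-trans)

  mutual
    data History : Set where
      root   : History
      extend : (h : History) (e : ℕ) (v : W) → iter S e (last h) ≼ v → History

    last : History → W
    last root             = w₀
    last (extend _ _ v _) = v

  stamp : History → ℕ
  stamp root             = 0
  stamp (extend h e _ _) = stamp h + e

  -- Number of extensions; it strictly grows along proper prefixes, which gives
  -- antisymmetry of ⊑ and uniqueness of chains in a layer.
  len : History → ℕ
  len root             = 0
  len (extend h _ _ _) = suc (len h)

  stamp-extend : ∀ h e v q d → stamp (extend h e v q) + d ≡ stamp h + (d + e)
  stamp-extend h e v q d = trans (+-assoc (stamp h) e d) (cong (stamp h +_) (+-comm e d))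

  data _⊑_ (h : History) : History → Set where
    ⊑-refl   : h ⊑ h
    ⊑-extend : ∀ {h' e v q} → h ⊑ h' → h ⊑ extend h' e v q

  data _⋖_ : History → History → Set where
    one-step : ∀ {h e v q} → h ⋖ extend h e v q

  ⊑-trans : ∀ {a b c} → a ⊑ b → b ⊑ c → a ⊑ c
  ⊑-trans a⊑b ⊑-refl          = a⊑b
  ⊑-trans a⊑b (⊑-extend b⊑c) = ⊑-extend (⊑-trans a⊑b b⊑c)

  ⊑-len : ∀ {a b} → a ⊑ b → len a ≤ len b
  ⊑-len ⊑-refl         = ≤-refl
  ⊑-len (⊑-extend a⊑b) = m≤n⇒m≤1+n (⊑-len a⊑b)

  ⊑-antisym : ∀ {a b} → a ⊑ b → b ⊑ a → a ≡ b
  ⊑-antisym ⊑-refl         _   = refl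
  ⊑-antisym (⊑-extend a⊑b) b⊑a = ⊥-elim (<-irrefl refl (≤-trans (s≤s (⊑-len a⊑b)) (⊑-len b⊑a)))

  root⊑ : ∀ h → root ⊑ h
  root⊑ root             = ⊑-refl
  root⊑ (extend h _ _ _) = ⊑-extend (root⊑ h)

  ⋖-len : ∀ {a b} → a ⋖ b → len b ≡ suc (len a)
  ⋖-len one-step = refl

  ⋖⇒⊑ : ∀ {a b} → a ⋖ b → a ⊑ b
  ⋖⇒⊑ one-step = ⊑-extend ⊑-refl

  prefix-by-len : ∀ {x y u} → x ⊑ u → y ⊑ u → len x ≡ len y → x ≡ y
  prefix-by-len ⊑-refl         ⊑-refl         _ = refl
  prefix-by-len ⊑-refl         (⊑-extend y⊑u) eq = ⊥-elim (<-irrefl (sym eq) (s≤s (⊑-len y⊑u)))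
  prefix-by-len (⊑-extend x⊑u) ⊑-refl         eq = ⊥-elim (<-irrefl eq (s≤s (⊑-len x⊑u)))
  prefix-by-len (⊑-extend x⊑u) (⊑-extend y⊑u) eq = prefix-by-len x⊑u y⊑u eq

  Point : Set
  Point = History × ℕ

  π : Point → W
  π (h , d) = iter S d (last h)

  layer : Point → ℕ
  layer (h , d) = stamp h + d

  _≼ᵤ_ : Rel Point 0ℓ
  x ≼ᵤ y = (proj₁ x ⊑ proj₁ y) × (layer x ≡ layer y)

  Sᵤ : Point → Point
  Sᵤ (h , d) = h , suc d

  layer-S : ∀ x → layer (Sᵤ x) ≡ suc (layer x)
  layer-S (h , d) = +-suc (stamp h) d

  prefix-forth : ∀ {h h'} d d' → h ⊑ h' → stamp h + d ≡ stamp h' + d' →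
                 iter S d (last h) ≼ iter S d' (last h')
  prefix-forth {h} d d' ⊑-refl eq rewrite +-cancelˡ-≡ (stamp h) d d' eq = ≼-refl
  prefix-forth d d' (⊑-extend {h'} {e} {v} {q} h⊑h') eq =
    ≼-trans (prefix-forth d (d' + e) h⊑h' (trans eq (stamp-extend h' e v q d')))
            (subst (_≼ iter S d' v) (sym (iter-+ S d' e (last h'))) (iter-mono M d' q))

  ≼ᵤ-isPartialOrder : IsPartialOrder _≡_ _≼ᵤ_
  ≼ᵤ-isPartialOrder = record
    { isPreorder = record
      { isEquivalence = isEquivalence
      ; reflexive     = λ { refl → ⊑-refl , refl }
      ; trans         = λ { (p , e) (p' , e') → ⊑-trans p p' , trans e e' } }
    ; antisym = antisym }
    where
    antisym : ∀ {x y} → x ≼ᵤ y → y ≼ᵤ x → x ≡ y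
    antisym {h , d} {h' , d'} (p , e) (p' , _) with ⊑-antisym p p'
    ... | refl = cong (h ,_) (+-cancelˡ-≡ (stamp h) d d' e)

  unravelled : IDM
  unravelled = record
    { W      = Point
    ; _≼_    = _≼ᵤ_
    ; isPO   = ≼ᵤ-isPartialOrder
    ; S      = Sᵤ
    ; S-mono = λ { {x} {y} (p , e) → p , trans (layer-S x) (trans (cong suc e) (sym (layer-S y))) }
    ; V      = λ x → V (π x)
    ; V-mono = λ { {x} {y} (p , e) → V-mono (prefix-forth (proj₂ x) (proj₂ y) p e) } }

  -- The projection is a bounded morphism; for the back condition, a world
  -- above π (h , d) is reached by extending h.
  projection : BoundedMorphism unravelled M
  projection = record
    { map     = π
    ; forth   = λ { {x} {y} (p , e) → prefix-forth (proj₂ x) (proj₂ y) p e }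
    ; back    = λ { {h , d} {v} π≼v →
                  (extend h d v π≼v , 0) , (⊑-extend ⊑-refl , sym (+-identityʳ _)) , refl }
    ; commute = λ _ → refl
    ; val     = λ _ _ → mk⇔ id id }

  module LayerTree (n : ℕ) where
    Layer : Set
    Layer = Σ Point (λ x → layer x ≡ n)

    history : Layer → History
    history a = proj₁ (proj₁ a)

    _◁_ : Rel Layer 0ℓ
    a ◁ b = history a ⋖ history b

    history-injective : ∀ {a b : Layer} → history a ≡ history b → a ≡ b
    history-injective {(h , d) , p} {(.h , d') , p'} refl
      with +-cancelˡ-≡ (stamp h) d d' (trans p (sym p'))
    ... | refl = cong ((h , d) ,_) (≡-irrelevant p p')

    prefix⇒star : ∀ (a : Layer) {h d} (p : stamp h + d ≡ n) → history a ⊑ h →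
                  Star _◁_ a ((h , d) , p)
    prefix⇒star a p ⊑-refl = subst (Star _◁_ a) (history-injective refl) ε
    prefix⇒star a {extend h e v q} {d} p (⊑-extend a⊑h) =
      prefix⇒star a (trans (sym (stamp-extend h e v q d)) p) a⊑h ◅◅ (one-step ◅ ε)

    star⇒prefix : ∀ {a b} → Star _◁_ a b → history a ⊑ history b
    star⇒prefix ε          = ⊑-refl
    star⇒prefix (s ◅ rest) = ⊑-trans (⋖⇒⊑ s) (star⇒prefix rest)

    chain⇒prefix : ∀ {a b} xs → ChainTo _◁_ a xs b → history a ⊑ history b
    chain⇒prefix xs chain = star⇒prefix (chain⇒star xs chain)

    no-return : ∀ {a y} → a ◁ y → history y ⊑ history a → ⊥
    no-return s y⊑a = <-irrefl refl (≤-trans (≤-reflexive (sym (⋖-len s))) (⊑-len y⊑a))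

    -- Two chains from a to u agree: their first steps are prefixes of u of
    -- the same length, hence equal.
    chains-unique : ∀ a u xs ys → ChainTo _◁_ a xs u → ChainTo _◁_ a ys u → xs ≡ ys
    chains-unique a u []       []       _        _          = refl
    chains-unique a u []       (y ∷ ys) refl     (s , c)    = ⊥-elim (no-return {a} {y} s (chain⇒prefix ys c))
    chains-unique a u (x ∷ xs) []       (s , c)  refl       = ⊥-elim (no-return {a} {x} s (chain⇒prefix xs c))
    chains-unique a u (x ∷ xs) (y ∷ ys) (s , c) (s' , c')
      with history-injective {x} {y}
             (prefix-by-len (chain⇒prefix xs c) (chain⇒prefix ys c') (trans (⋖-len s) (sym (⋖-len s'))))
    ... | refl = cong (x ∷_) (chains-unique x u xs ys c c')

    base : Layer
    base = (root , n) , refl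

    tree : IsTree Layer (λ a b → proj₁ a ≼ᵤ proj₁ b)
    tree = _◁_
         , (λ a b → (λ a≤b → prefix⇒star a (proj₂ b) (proj₁ a≤b))
                  , (λ st → star⇒prefix st , trans (proj₂ a) (sym (proj₂ b))))
         , base
         , (λ u → star⇒chain (prefix⇒star base (proj₂ u) (root⊑ (history u)))
                , chains-unique base u)

  expanding : IsExpanding unravelled
  expanding = (layer , (λ x≼y → sym (proj₂ x≼y)) , LayerTree.tree , layer-S)
            , λ { {x} {y} (p , e) → p , suc-injective (trans (sym (layer-S x)) (trans e (layer-S y))) }

expanding-equivalent : (M : IDM) (w : IDM.W M) →
  ∃[ N ] (IsExpanding N × ∃[ x ] (∀ φ → (N , x ⊨ φ) ⇔ (M , w ⊨ φ)))
expanding-equivalent M w =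
  unravelled , expanding , (root , 0) , λ φ → truth-invariance projection φ (root , 0)
  where open Unravelling M w

forget-expanding : {P : (M : IDM) → IDM.W M → Set} →
  ∃[ M ] (IsExpanding M × ∃[ w ] P M w) → ∃[ M ] ∃[ w ] P M w
forget-expanding (M , _ , w , m) = M , w , m

theorem8 : (φ : Form) →
    ((∃[ M ] ∃[ w ] (M , w ⊨ φ)) ⇔ (∃[ M ] (IsExpanding M × ∃[ w ] (M , w ⊨ φ))))
    × ((∃[ M ] ∃[ w ] ¬ (M , w ⊨ φ)) ⇔ (∃[ M ] (IsExpanding M × ∃[ w ] ¬ (M , w ⊨ φ))))
theorem8 φ = mk⇔ satisfiable forget-expanding , mk⇔ falsifiable forget-expanding
  where
  satisfiable : ∃[ M ] ∃[ w ] (M , w ⊨ φ) → ∃[ M ] (IsExpanding M × ∃[ w ] (M , w ⊨ φ))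
  satisfiable (M , w , m) with expanding-equivalent M w
  ... | N , exp , x , equiv = N , exp , x , Equivalence.from (equiv φ) m

  falsifiable : ∃[ M ] ∃[ w ] ¬ (M , w ⊨ φ) → ∃[ M ] (IsExpanding M × ∃[ w ] ¬ (M , w ⊨ φ))
  falsifiable (M , w , m) with expanding-equivalent M w
  ... | N , exp , x , equiv = N , exp , x , λ n → m (Equivalence.to (equiv φ) n)
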